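{- Let $\Phi$ be a finite crystallographic root system with Weyl group $W$ and let $R$ be a $\Phi$-poset. Then $R\in\mathrm{WOIP}(\Phi)$ if and only if: for all $\alpha,\beta\in\Phi^-$ and for all $\alpha,\beta\in\Phi^+$, $\alpha+\beta\in R$ implies $\alpha\in R$ or $\beta\in R$.
   Context: Let $V$ be a real Euclidean space with scalar product $\langle\cdot,\cdot\rangle$. For $\alpha\neq0$ let $\alpha^\vee=2\alpha/\langle\alpha,\alpha\rangle$ and $s_\alpha(v)=v-\langle\alpha^\vee,v\rangle\alpha$. A finite root system is a finite set $\Phi\subset V\setminus\{0\}$ with $\Phi\cap\mathbb{R}\alpha=\{\alpha,-\alpha\}$ and $s_\alpha\Phi=\Phi$ for all $\alpha\in\Phi$; it is crystallographic if $\langle\alpha^\vee,\beta\rangle\in\mathbb{Z}$ for all $\alpha,\beta\in\Phi$; $W$ is the group generated by the $s_\alpha$. Fix a generic linear functional $f$ and let $\Phi^+=\{\alpha\in\Phi: f(\alpha)>0\}$, $\Phi^-=\{\alpha\in\Phi:f(\alpha)<0\}$. For $R\subseteq\Phi$ write $R^+=R\cap\Phi^+$, $R^-=R\cap\Phi^-$. A subset $R$ is antisymmetric if $R\cap-R=\varnothing$, and closed if $\alpha,\beta\in R$, $m,n\in\mathbb{N}$, $m\alpha+n\beta\in\Phi$ imply $m\alpha+n\beta\in R$; a $\Phi$-poset is an antisymmetric closed subset. For $w\in W$ let $R(w)=w(\Phi^+)$ and $\mathrm{inv}(w)=\Phi^+\cap w(\Phi^-)$; the weak order on $W$ is $v\le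 w$ iff $\mathrm{inv}(v)\subseteq\mathrm{inv}(w)$. For $w\le w'$ set $R(w,w')=R(w)\cap R(w')=R(w)^-\sqcup R(w')^+$, and $\mathrm{WOIP}(\Phi)=\{R(w,w'): w,w'\in W,\ w\le w'\}$.
   Formalization: The space V is ℚ^n with the standard scalar product, and the generic functional f is the scalar product with a rational vector, in place of a real Euclidean space and a real functional. -}

module Defs where

open import Data.Nat using (ℕ)
open import Data.Integer using (ℤ; +_)
open import Data.Rational using (ℚ; 0ℚ; 1ℚ; _+_; _*_; _-_; -_; _<_; _÷_; _/_; ≢-nonZero)
open import Data.Rational.Properties using (_≟_)
open import Data.Vec using (Vec; zipWith; map; foldr; replicate)
open import Data.List using (List; []; _∷_)
open import Data.List.Membership.Propositional using (_∈_)
open import Data.List.Relation.Unary.All using (All)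
open import Data.Product using (Σ; ∃; _×_; _,_)
open import Data.Sum using (_⊎_)
open import Relation.Nullary using (¬_; yes; no)
open import Relation.Binary.PropositionalEquality using (_≡_; _≢_)

-- The Euclidean space V is modelled as ℚⁿ with the standard scalar product.
V : ℕ → Set
V n = Vec ℚ n

module _ {n : ℕ} where

  _+ᵥ_ : V n → V n → V n
  _+ᵥ_ = zipWith _+_

  _-ᵥ_ : V n → V n → V n
  _-ᵥ_ = zipWith _-_

  _·ᵥ_ : ℚ → V n → V n
  c ·ᵥ v = map (c *_) v

  negᵥ : V n → V n
  negᵥ = map (λ q → - q)

  0ᵥ : V n
  0ᵥ = replicate n 0ℚ

  ⟨_,_⟩ : V n → V n → ℚ
  ⟨ u , v ⟩ = foldr (λ _ → ℚ) _+_ 0ℚ (zipWith _*_ u v)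

  ℕtoℚ : ℕ → ℚ
  ℕtoℚ m = (+ m) / 1

  ℤtoℚ : ℤ → ℚ
  ℤtoℚ k = k / 1

  -- ⟨α^∨ , v⟩ = 2⟨α,v⟩/⟨α,α⟩  (the value for α = 0 is irrelevant: set to 0)
  coroot-pair : V n → V n → ℚ
  coroot-pair α v with ⟨ α , α ⟩ ≟ 0ℚ
  ... | yes _ = 0ℚ
  ... | no ne = ((ℕtoℚ 2) * ⟨ α , v ⟩) ÷ ⟨ α , α ⟩
    where instance _ = ≢-nonZero ne

  s : V n → V n → V n
  s α v = v -ᵥ (coroot-pair α v ·ᵥ α)

  record IsRootSystem (Φ : List (V n)) : Set where
    field
      nonzero     : ¬ (0ᵥ ∈ Φ)
      -- Φ ∩ ℝα = {α, -α}  (a real c with cα ∈ Φ ⊆ ℚⁿ, α ≠ 0, is rational)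
      lines       : ∀ {α} → α ∈ Φ → ∀ (c : ℚ) → (c ·ᵥ α) ∈ Φ → (c ≡ 1ℚ ⊎ c ≡ - 1ℚ)
      neg-mem     : ∀ {α} → α ∈ Φ → negᵥ α ∈ Φ
      -- s_α Φ = Φ (⊆ suffices: s_α is injective and Φ finite)
      refl-stable : ∀ {α β} → α ∈ Φ → β ∈ Φ → s α β ∈ Φ

  IsCrystallographic : List (V n) → Set
  IsCrystallographic Φ = ∀ {α β} → α ∈ Φ → β ∈ Φ → ∃ λ (k : ℤ) → coroot-pair α β ≡ ℤtoℚ k

  -- the linear functional f is represented by a vector φ: f(v) = ⟨φ,v⟩
  IsGeneric : List (V n) → V n → Set
  IsGeneric Φ φ = ∀ {α} → α ∈ Φ → ¬ (⟨ φ , α ⟩ ≡ 0ℚ)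

  module RootData (Φ : List (V n)) (φ : V n) where

    Positive : V n → Set
    Positive α = (α ∈ Φ) × (0ℚ < ⟨ φ , α ⟩)

    Negative : V n → Set
    Negative α = (α ∈ Φ) × (⟨ φ , α ⟩ < 0ℚ)

    -- elements of W: words in the generating reflections s_α, α ∈ Φ
    Word : Set
    Word = Σ (List (V n)) (All (_∈ Φ))

    act : List (V n) → V n → V n
    act [] v = v
    act (α ∷ w) v = s α (act w v)

    actW : Word → V n → V n
    actW (w , _) = act w

    InR : Word → V n → Set
    InR w γ = ∃ λ β → Positive β × actW w β ≡ γ

    InInv : Word → V n → Set
    InInv w γ = Positive γ × (∃ λ β → Negative β × actW w β ≡ γ)

    _≤W_ : Word → Word → Set
    v ≤W w = ∀ γ → InInv v γ → InInv w γ

    InRR : Word → Word → V n → Set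
    InRR w w' γ = InR w γ × InR w' γ

    InWOIP : List (V n) → Set
    InWOIP R = ∃ λ w → ∃ λ w' → (w ≤W w') × (∀ γ → (γ ∈ R → InRR w w' γ) × (InRR w w' γ → γ ∈ R))

    Antisymmetric : List (V n) → Set
    Antisymmetric R = ∀ {γ} → γ ∈ R → ¬ (negᵥ γ ∈ R)

    Closed : List (V n) → Set
    Closed R = ∀ {α β} → α ∈ R → β ∈ R → ∀ (m k : ℕ) →
      ((ℕtoℚ m ·ᵥ α) +ᵥ (ℕtoℚ k ·ᵥ β)) ∈ Φ → ((ℕtoℚ m ·ᵥ α) +ᵥ (ℕtoℚ k ·ᵥ β)) ∈ R

    IsΦPoset : List (V n) → Set
    IsΦPoset R = (∀ {γ} → γ ∈ R → γ ∈ Φ) × Antisymmetric R × Closed R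

    Condition : List (V n) → Set
    Condition R =
      (∀ {α β} → Negative α → Negative β → (α +ᵥ β) ∈ R → (α ∈ R ⊎ β ∈ R)) ×
      (∀ {α β} → Positive α → Positive β → (α +ᵥ β) ∈ R → (α ∈ R ⊎ β ∈ R))

{-# OPTIONS --safe #-}

-- Encode R(w) = w(Φ⁺) as the set of roots γ with ⟨ w(φ) , γ ⟩ > 0.  If R = R(w) ∩ R(w′) with w ≤ w′
-- and α + β ∈ R, one of α, β lies in R(w) (and one in R(w′)); for negative (resp. positive) α, β the
-- inclusion inv(w) ⊆ inv(w′) puts that summand into R(w′) (resp. R(w)) as well.
-- Conversely, the condition makes R⁻ ⊔ (Φ⁺ ∖ −R) and R⁺ ⊔ (Φ⁻ ∖ −R) closed, and each contains exactly
-- one of ±γ for every root γ.  Such a set is some w(Φ⁺): as long as a root is positive for the current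
-- chamber but outside the set, reflect in a minimal such root; it is simple, and a simple reflection
-- permutes the other positive roots, so fewer roots are misplaced.  The two chambers w ≤ w′ obtained
-- this way satisfy R = R(w) ∩ R(w′).

module Submission where

open import Defs
open import Data.Nat using (ℕ; zero; suc; s≤s; z≤n)
import Data.Nat as ℕ
import Data.Nat.Properties as ℕP
open import Data.Nat.Induction using (<-wellFounded)
open import Induction.WellFounded using (Acc; acc)
open import Data.Integer using (ℤ; +_; -[1+_])
import Data.Integer as ℤ
open import Data.Rational using (ℚ; 0ℚ; 1ℚ; _+_; _*_; _-_; -_; _<_; _≤_; _÷_; _/_; ≢-nonZero; 1/_; mkℚ; *≤*)
import Data.Rational as ℚ
import Data.Rational.Properties as ℚP
open import Data.Rational.Properties using (_≟_)
open import Algebra.Properties.Group ℚP.+-0-group using () renaming (⁻¹-involutive to neg-involutive)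
open import Data.Rational.Solver using (module +-*-Solver)
open +-*-Solver using (solve; _:=_; _:+_; _:*_; _:-_; :-_; con)
import Data.Nat.Coprimality as Coprimality
open import Data.Vec using (Vec; []; _∷_)
import Data.Vec.Properties as VecP
open import Data.List using (List; []; _∷_; filter)
open import Data.List.Membership.Propositional using (_∈_; lose; find)
open import Data.List.Membership.Propositional.Properties using (∈-filter⁺; ∈-filter⁻)
open import Data.List.Relation.Unary.Any using (here; there; any?)
open import Data.List.Relation.Unary.All using (All; []; _∷_)
import Data.List.Relation.Unary.All as All
open import Relation.Binary.Bundles using (DecTotalOrder)
import Data.List.Extrema (DecTotalOrder.totalOrder ℚP.≤-decTotalOrder) as Extrema
open import Data.Product using (∃; ∃₂; _×_; _,_; proj₁; proj₂)
open import Data.Sum using (_⊎_; inj₁; inj₂; [_,_]′)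
import Data.Sum as Sum
open import Data.Empty using (⊥-elim)
open import Function using (id; _∘_; _⇔_; mk⇔; Equivalence)
open import Relation.Nullary using (¬_; ¬?; yes; no; _×-dec_)
open import Relation.Nullary.Decidable using (decidable-stable; _⊎-dec_)
open import Relation.Unary using (Pred; Decidable)
open import Level using (0ℓ)
open import Relation.Binary.PropositionalEquality
open import Relation.Binary.Definitions using (DecidableEquality; tri<; tri≈; tri>)

private variable n : ℕ

two : ℚ
two = + 2 / 1

<⇒≱ : ∀ {p q} → p < q → ¬ q ≤ p
<⇒≱ p<q q≤p = ℚP.<-irrefl refl (ℚP.<-≤-trans p<q q≤p)

≢0⇒<0⊎>0 : ∀ {p} → p ≢ 0ℚ → p < 0ℚ ⊎ 0ℚ < p
≢0⇒<0⊎>0 {p} p≢0 with ℚP.<-cmp p 0ℚ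
... | tri< p<0 _ _ = inj₁ p<0
... | tri≈ _ p≡0 _ = ⊥-elim (p≢0 p≡0)
... | tri> _ _ p>0 = inj₂ p>0

0<-p⇒p<0 : ∀ {p} → 0ℚ < - p → p < 0ℚ
0<-p⇒p<0 {p} 0<-p = subst (_< 0ℚ) (neg-involutive p) (ℚP.neg-antimono-< 0<-p)

-p<0⇒0<p : ∀ {p} → - p < 0ℚ → 0ℚ < p
-p<0⇒0<p {p} -p<0 = subst (0ℚ <_) (neg-involutive p) (ℚP.neg-antimono-< -p<0)

0<p+q⇒0<p⊎0<q : ∀ {p q} → 0ℚ < p + q → 0ℚ < p ⊎ 0ℚ < q
0<p+q⇒0<p⊎0<q {p} {q} 0<p+q with ℚP._<?_ 0ℚ p | ℚP._<?_ 0ℚ q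
... | yes 0<p | _     = inj₁ 0<p
... | no _    | yes 0<q = inj₂ 0<q
... | no 0≮p  | no 0≮q =
  ⊥-elim (<⇒≱ 0<p+q (ℚP.+-mono-≤ (ℚP.≮⇒≥ 0≮p) (ℚP.≮⇒≥ 0≮q)))

0<p*q : ∀ {p q} → 0ℚ < p → 0ℚ < q → 0ℚ < p * q
0<p*q {p} {q} 0<p 0<q = ℚP.positive⁻¹ _ {{ℚP.pos*pos⇒pos p {{ℚ.positive 0<p}} q {{ℚ.positive 0<q}}}}

0<p*q⇒0<p : ∀ {p q} → 0ℚ < q → 0ℚ < p * q → 0ℚ < p
0<p*q⇒0<p {p} {q} 0<q 0<pq =
  ℚP.*-cancelʳ-<-nonNeg q {{ℚ.nonNegative (ℚP.<⇒≤ 0<q)}} (subst (_< p * q) (sym (ℚP.*-zeroˡ q)) 0<pq)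

p-q<0⇒p<q : ∀ {p q} → p - q < 0ℚ → p < q
p-q<0⇒p<q {p} {q} p-q<0 = subst₂ _<_ (solve 2 (λ p q → (p :- q) :+ q := p) refl p q) (ℚP.+-identityˡ q)
  (ℚP.+-monoˡ-< q p-q<0)

p-q<p : ∀ p {q} → 0ℚ < q → p - q < p
p-q<p p {q} 0<q = subst (p - q <_) (ℚP.+-identityʳ p) (ℚP.+-monoʳ-< p (ℚP.neg-antimono-< 0<q))

p<p+q : ∀ p {q} → 0ℚ < q → p < p + q
p<p+q p {q} 0<q = subst (_< p + q) (ℚP.+-identityʳ p) (ℚP.+-monoʳ-< p 0<q)

q<p+q : ∀ {p} q → 0ℚ < p → q < p + q
q<p+q {p} q 0<p = subst (q <_) (ℚP.+-comm q p) (p<p+q q 0<p)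

-- k / 1 is stuck unless k is a literal; its normal form below computes by cases on k.
integer : ℤ → ℚ
integer k = mkℚ k 0 (Coprimality.sym (Coprimality.1-coprimeTo ℤ.∣ k ∣))

integer-pos≢1⇒≥2 : ∀ k → 0ℚ < integer k → integer k ≢ 1ℚ → two ≤ integer k
integer-pos≢1⇒≥2 (+ zero)        0<0 _   = ⊥-elim (ℚP.<-irrefl refl 0<0)
integer-pos≢1⇒≥2 (+ suc zero)    _   1≢1 = ⊥-elim (1≢1 refl)
integer-pos≢1⇒≥2 (+ suc (suc m)) _   _   = *≤* (ℤ.+≤+ (s≤s (s≤s z≤n)))
integer-pos≢1⇒≥2 -[1+ m ]        0<k _   = ⊥-elim (ℚP.<-asym 0<k (ℚP.negative⁻¹ _))

k/1≡integer : ∀ k → k / 1 ≡ integer k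
k/1≡integer k = ℚP.↥p/↧p≡p (integer k)

module _ {A : Set} where

  ∃-minimal : {P : Pred A 0ℓ} → Decidable P → (f : A → ℚ) → ∀ {x xs} → x ∈ xs → P x →
              ∃ λ m → m ∈ xs × P m × (∀ {y} → y ∈ xs → P y → f m ≤ f y)
  ∃-minimal {P} P? f {x} {xs} x∈xs Px =
    m , proj₁ m∈xs×Pm , proj₂ m∈xs×Pm ,
    λ y∈xs Py → All.lookup (Extrema.f[argmin]≤f[xs] x (filter P? xs)) (∈-filter⁺ P? y∈xs Py)
    where
    m = Extrema.argmin f x (filter P? xs)
    m∈xs×Pm : m ∈ xs × P m
    m∈xs×Pm = Extrema.argmin-all f (x∈xs , Px) (All.tabulate (∈-filter⁻ P?))

  count : {P : Pred A 0ℓ} → Decidable P → List A → ℕ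
  count P? []       = 0
  count P? (a ∷ xs) with P? a
  ... | yes _ = suc (count P? xs)
  ... | no  _ = count P? xs

  module _ {P Q : Pred A 0ℓ} (P? : Decidable P) (Q? : Decidable Q) where

    count-mono : ∀ xs → (∀ {x} → x ∈ xs → P x → Q x) → count P? xs ℕ.≤ count Q? xs
    count-mono []       _   = z≤n
    count-mono (a ∷ xs) P⊆Q with P? a | Q? a
    ... | yes _  | yes _  = s≤s (count-mono xs (P⊆Q ∘ there))
    ... | yes Pa | no ¬Qa = ⊥-elim (¬Qa (P⊆Q (here refl) Pa))
    ... | no _   | yes _  = ℕP.m≤n⇒m≤1+n (count-mono xs (P⊆Q ∘ there))
    ... | no _   | no _   = count-mono xs (P⊆Q ∘ there)

    count-strictMono : ∀ xs → (∀ {x} → x ∈ xs → P x → Q x) →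
                       ∀ {x} → x ∈ xs → Q x → ¬ P x → count P? xs ℕ.< count Q? xs
    count-strictMono (a ∷ xs) P⊆Q (here refl) Qa ¬Pa with P? a | Q? a
    ... | yes Pa | _      = ⊥-elim (¬Pa Pa)
    ... | no _   | no ¬Qa = ⊥-elim (¬Qa Qa)
    ... | no _   | yes _  = s≤s (count-mono xs (P⊆Q ∘ there))
    count-strictMono (a ∷ xs) P⊆Q (there x∈xs) Qx ¬Px with P? a | Q? a
    ... | yes _  | yes _  = s≤s (count-strictMono xs (P⊆Q ∘ there) x∈xs Qx ¬Px)
    ... | yes Pa | no ¬Qa = ⊥-elim (¬Qa (P⊆Q (here refl) Pa))
    ... | no _   | yes _  = ℕP.m≤n⇒m≤1+n (count-strictMono xs (P⊆Q ∘ there) x∈xs Qx ¬Px)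
    ... | no _   | no _   = count-strictMono xs (P⊆Q ∘ there) x∈xs Qx ¬Px

-- Vectors, the scalar product and reflections

_≟ᵥ_ : DecidableEquality (V n)
_≟ᵥ_ = VecP.≡-dec _≟_

·ᵥ-identityˡ : (v : V n) → 1ℚ ·ᵥ v ≡ v
·ᵥ-identityˡ []      = refl
·ᵥ-identityˡ (x ∷ v) = cong₂ _∷_ (ℚP.*-identityˡ x) (·ᵥ-identityˡ v)

negᵥ-involutive : (v : V n) → negᵥ (negᵥ v) ≡ v
negᵥ-involutive []      = refl
negᵥ-involutive (x ∷ v) = cong₂ _∷_ (neg-involutive x) (negᵥ-involutive v)

negᵥ-distrib-+ᵥ : (u v : V n) → negᵥ (u +ᵥ v) ≡ negᵥ u +ᵥ negᵥ v
negᵥ-distrib-+ᵥ []      []      = refl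
negᵥ-distrib-+ᵥ (x ∷ u) (y ∷ v) = cong₂ _∷_ (ℚP.neg-distrib-+ x y) (negᵥ-distrib-+ᵥ u v)

+ᵥ-comm : (u v : V n) → u +ᵥ v ≡ v +ᵥ u
+ᵥ-comm []      []      = refl
+ᵥ-comm (x ∷ u) (y ∷ v) = cong₂ _∷_ (ℚP.+-comm x y) (+ᵥ-comm u v)

-[u-v]≡v-u : (u v : V n) → negᵥ (u -ᵥ v) ≡ v -ᵥ u
-[u-v]≡v-u []      []      = refl
-[u-v]≡v-u (x ∷ u) (y ∷ v) = cong₂ _∷_ (solve 2 (λ x y → :- (x :- y) := y :- x) refl x y) (-[u-v]≡v-u u v)

u+[v-u]≡v : (u v : V n) → u +ᵥ (v -ᵥ u) ≡ v
u+[v-u]≡v []      []      = refl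
u+[v-u]≡v (x ∷ u) (y ∷ v) = cong₂ _∷_ (solve 2 (λ x y → x :+ (y :- x) := y) refl x y) (u+[v-u]≡v u v)

[u+v]-v≡u : (u v : V n) → (u +ᵥ v) +ᵥ negᵥ v ≡ u
[u+v]-v≡u []      []      = refl
[u+v]-v≡u (x ∷ u) (y ∷ v) = cong₂ _∷_ (solve 2 (λ x y → (x :+ y) :+ (:- y) := x) refl x y) ([u+v]-v≡u u v)

-[u+v]+u≡-v : (u v : V n) → negᵥ (u +ᵥ v) +ᵥ u ≡ negᵥ v
-[u+v]+u≡-v []      []      = refl
-[u+v]+u≡-v (x ∷ u) (y ∷ v) = cong₂ _∷_ (solve 2 (λ x y → (:- (x :+ y)) :+ x := :- y) refl x y) (-[u+v]+u≡-v u v)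

u-v≡0⇒u≡v : (u v : V n) → u -ᵥ v ≡ 0ᵥ → u ≡ v
u-v≡0⇒u≡v []      []      _ = refl
u-v≡0⇒u≡v (x ∷ u) (y ∷ v) e = cong₂ _∷_ x≡y (u-v≡0⇒u≡v u v (cong Data.Vec.tail e))
  where
  x≡y : x ≡ y
  x≡y = begin
    x             ≡⟨ solve 2 (λ x y → x := (x :- y) :+ y) refl x y ⟩
    (x - y) + y   ≡⟨ cong (_+ y) (cong Data.Vec.head e) ⟩
    0ℚ + y        ≡⟨ ℚP.+-identityˡ y ⟩
    y             ∎
    where open ≡-Reasoning

u-v≡v⇒u≡2v : (u v : V n) → u -ᵥ v ≡ v → u ≡ two ·ᵥ v
u-v≡v⇒u≡2v []      []      _ = refl
u-v≡v⇒u≡2v (x ∷ u) (y ∷ v) e = cong₂ _∷_ x≡2y (u-v≡v⇒u≡2v u v (cong Data.Vec.tail e))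
  where
  x≡2y : x ≡ two * y
  x≡2y = begin
    x             ≡⟨ solve 2 (λ x y → x := (x :- y) :+ y) refl x y ⟩
    (x - y) + y   ≡⟨ cong (_+ y) (cong Data.Vec.head e) ⟩
    y + y         ≡⟨ solve 1 (λ y → y :+ y := con two :* y) refl y ⟩
    two * y       ∎
    where open ≡-Reasoning

⟨,⟩-comm : (u v : V n) → ⟨ u , v ⟩ ≡ ⟨ v , u ⟩
⟨,⟩-comm []      []      = refl
⟨,⟩-comm (x ∷ u) (y ∷ v) = cong₂ _+_ (ℚP.*-comm x y) (⟨,⟩-comm u v)

⟨,⟩-+ᵥ : (u v w : V n) → ⟨ u , v +ᵥ w ⟩ ≡ ⟨ u , v ⟩ + ⟨ u , w ⟩
⟨,⟩-+ᵥ []      []      []      = refl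
⟨,⟩-+ᵥ (x ∷ u) (y ∷ v) (z ∷ w) rewrite ⟨,⟩-+ᵥ u v w =
  solve 5 (λ x y z a b → x :* (y :+ z) :+ (a :+ b) := (x :* y :+ a) :+ (x :* z :+ b)) refl x y z ⟨ u , v ⟩ ⟨ u , w ⟩

⟨,⟩-subᵥ : (u v w : V n) → ⟨ u , v -ᵥ w ⟩ ≡ ⟨ u , v ⟩ - ⟨ u , w ⟩
⟨,⟩-subᵥ []      []      []      = refl
⟨,⟩-subᵥ (x ∷ u) (y ∷ v) (z ∷ w) rewrite ⟨,⟩-subᵥ u v w =
  solve 5 (λ x y z a b → x :* (y :- z) :+ (a :- b) := (x :* y :+ a) :- (x :* z :+ b)) refl x y z ⟨ u , v ⟩ ⟨ u , w ⟩

⟨,⟩-negᵥ : (u v : V n) → ⟨ u , negᵥ v ⟩ ≡ - ⟨ u , v ⟩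
⟨,⟩-negᵥ []      []      = refl
⟨,⟩-negᵥ (x ∷ u) (y ∷ v) rewrite ⟨,⟩-negᵥ u v =
  solve 3 (λ x y a → x :* (:- y) :+ (:- a) := :- (x :* y :+ a)) refl x y ⟨ u , v ⟩

⟨,⟩-·ᵥ : (u v : V n) (c : ℚ) → ⟨ u , c ·ᵥ v ⟩ ≡ c * ⟨ u , v ⟩
⟨,⟩-·ᵥ []      []      c = sym (ℚP.*-zeroʳ c)
⟨,⟩-·ᵥ (x ∷ u) (y ∷ v) c rewrite ⟨,⟩-·ᵥ u v c =
  solve 4 (λ x y c a → x :* (c :* y) :+ c :* a := c :* (x :* y :+ a)) refl x y c ⟨ u , v ⟩

⟨negᵥ,⟩ : (u v : V n) → ⟨ negᵥ u , v ⟩ ≡ - ⟨ u , v ⟩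
⟨negᵥ,⟩ u v = trans (⟨,⟩-comm (negᵥ u) v) (trans (⟨,⟩-negᵥ v u) (cong -_ (⟨,⟩-comm v u)))

⟨u,v⟩<0⇒0<⟨u,-v⟩ : (u v : V n) → ⟨ u , v ⟩ < 0ℚ → 0ℚ < ⟨ u , negᵥ v ⟩
⟨u,v⟩<0⇒0<⟨u,-v⟩ u v ⟨u,v⟩<0 = subst (0ℚ <_) (sym (⟨,⟩-negᵥ u v)) (ℚP.neg-antimono-< ⟨u,v⟩<0)

0<⟨u,v⟩⇒⟨u,-v⟩<0 : (u v : V n) → 0ℚ < ⟨ u , v ⟩ → ⟨ u , negᵥ v ⟩ < 0ℚ
0<⟨u,v⟩⇒⟨u,-v⟩<0 u v 0<⟨u,v⟩ = subst (_< 0ℚ) (sym (⟨,⟩-negᵥ u v)) (ℚP.neg-antimono-< 0<⟨u,v⟩)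

⟨u,-v⟩<0⇒0<⟨u,v⟩ : (u v : V n) → ⟨ u , negᵥ v ⟩ < 0ℚ → 0ℚ < ⟨ u , v ⟩
⟨u,-v⟩<0⇒0<⟨u,v⟩ u v ⟨u,-v⟩<0 = -p<0⇒0<p (subst (_< 0ℚ) (⟨,⟩-negᵥ u v) ⟨u,-v⟩<0)

0<⟨u,-v⟩⇒⟨u,v⟩<0 : (u v : V n) → 0ℚ < ⟨ u , negᵥ v ⟩ → ⟨ u , v ⟩ < 0ℚ
0<⟨u,-v⟩⇒⟨u,v⟩<0 u v 0<⟨u,-v⟩ = 0<-p⇒p<0 (subst (0ℚ <_) (⟨,⟩-negᵥ u v) 0<⟨u,-v⟩)

⟨u-v,u-v⟩ : (u v : V n) → ⟨ u -ᵥ v , u -ᵥ v ⟩ ≡ (⟨ u , u ⟩ + ⟨ v , v ⟩) - two * ⟨ u , v ⟩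
⟨u-v,u-v⟩ []      []      = refl
⟨u-v,u-v⟩ (x ∷ u) (y ∷ v) rewrite ⟨u-v,u-v⟩ u v =
  solve 5 (λ x y p q r → (x :- y) :* (x :- y) :+ ((p :+ q) :- con two :* r)
                      := ((x :* x :+ p) :+ (y :* y :+ q)) :- con two :* (x :* y :+ r))
        refl x y ⟨ u , u ⟩ ⟨ v , v ⟩ ⟨ u , v ⟩

0≤x*x : ∀ x → 0ℚ ≤ x * x
0≤x*x x with ℚP.≤-total 0ℚ x
... | inj₁ 0≤x = ℚP.nonNegative⁻¹ _ {{ℚP.nonNeg*nonNeg⇒nonNeg x {{ℚ.nonNegative 0≤x}} x {{ℚ.nonNegative 0≤x}}}}
... | inj₂ x≤0 = ℚP.nonNegative⁻¹ _ {{ℚP.nonPos*nonPos⇒nonPos x {{ℚ.nonPositive x≤0}} x {{ℚ.nonPositive x≤0}}}}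

x*x≤0⇒x≡0 : ∀ x → x * x ≤ 0ℚ → x ≡ 0ℚ
x*x≤0⇒x≡0 x xx≤0 with ℚP.<-cmp x 0ℚ
... | tri< x<0 _ _ = ⊥-elim (<⇒≱ (ℚP.positive⁻¹ _ {{ℚP.neg*neg⇒pos x {{ℚ.negative x<0}} x {{ℚ.negative x<0}}}}) xx≤0)
... | tri≈ _ x≡0 _ = x≡0
... | tri> _ _ 0<x = ⊥-elim (<⇒≱ (ℚP.positive⁻¹ _ {{ℚP.pos*pos⇒pos x {{ℚ.positive 0<x}} x {{ℚ.positive 0<x}}}}) xx≤0)

⟨u,u⟩-nonNeg : (u : V n) → 0ℚ ≤ ⟨ u , u ⟩
⟨u,u⟩-nonNeg []      = ℚP.≤-refl
⟨u,u⟩-nonNeg (x ∷ u) = ℚP.+-mono-≤ (0≤x*x x) (⟨u,u⟩-nonNeg u)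

⟨u,u⟩≤0⇒u≡0 : (u : V n) → ⟨ u , u ⟩ ≤ 0ℚ → u ≡ 0ᵥ
⟨u,u⟩≤0⇒u≡0 []      _    = refl
⟨u,u⟩≤0⇒u≡0 (x ∷ u) ≤0 = cong₂ _∷_ (x*x≤0⇒x≡0 x xx≤0) (⟨u,u⟩≤0⇒u≡0 u uu≤0)
  where
  xx≤0 : x * x ≤ 0ℚ
  xx≤0 = ℚP.≤-trans (subst (_≤ x * x + ⟨ u , u ⟩) (ℚP.+-identityʳ _) (ℚP.+-monoʳ-≤ (x * x) (⟨u,u⟩-nonNeg u))) ≤0
  uu≤0 : ⟨ u , u ⟩ ≤ 0ℚ
  uu≤0 = ℚP.≤-trans (subst (_≤ x * x + ⟨ u , u ⟩) (ℚP.+-identityˡ _) (ℚP.+-monoˡ-≤ ⟨ u , u ⟩ (0≤x*x x))) ≤0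

-- α^∨ = coroot-factor α ·ᵥ α, with the same junk value 0 at α = 0 as coroot-pair.
coroot-factor : V n → ℚ
coroot-factor α with ⟨ α , α ⟩ ≟ 0ℚ
... | yes _        = 0ℚ
... | no ⟨α,α⟩≢0 = two ÷ ⟨ α , α ⟩
  where instance _ = ≢-nonZero ⟨α,α⟩≢0

coroot-pair≡⟨,⟩*factor : (α v : V n) → coroot-pair α v ≡ ⟨ α , v ⟩ * coroot-factor α
coroot-pair≡⟨,⟩*factor α v with ⟨ α , α ⟩ ≟ 0ℚ
... | yes _        = sym (ℚP.*-zeroʳ ⟨ α , v ⟩)
... | no ⟨α,α⟩≢0 = solve 3 (λ t x i → (t :* x) :* i := x :* (t :* i)) refl two ⟨ α , v ⟩ (1/ ⟨ α , α ⟩)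
  where instance _ = ≢-nonZero ⟨α,α⟩≢0

coroot-factor*⟨α,α⟩ : (α : V n) → ⟨ α , α ⟩ ≢ 0ℚ → coroot-factor α * ⟨ α , α ⟩ ≡ two
coroot-factor*⟨α,α⟩ α ⟨α,α⟩≢0 with ⟨ α , α ⟩ ≟ 0ℚ
... | yes ⟨α,α⟩≡0 = ⊥-elim (⟨α,α⟩≢0 ⟨α,α⟩≡0)
... | no ⟨α,α⟩≢0′ = begin
  (two * 1/ ⟨ α , α ⟩) * ⟨ α , α ⟩   ≡⟨ ℚP.*-assoc two (1/ ⟨ α , α ⟩) ⟨ α , α ⟩ ⟩
  two * (1/ ⟨ α , α ⟩ * ⟨ α , α ⟩)   ≡⟨ cong (two *_) (ℚP.*-inverseˡ ⟨ α , α ⟩) ⟩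
  two * 1ℚ                           ≡⟨ ℚP.*-identityʳ two ⟩
  two                                ∎
  where
  open ≡-Reasoning
  instance _ = ≢-nonZero ⟨α,α⟩≢0′

coroot-pair*⟨α,α⟩ : (α v : V n) → ⟨ α , α ⟩ ≢ 0ℚ → coroot-pair α v * ⟨ α , α ⟩ ≡ two * ⟨ α , v ⟩
coroot-pair*⟨α,α⟩ α v ⟨α,α⟩≢0 = begin
  coroot-pair α v * ⟨ α , α ⟩                ≡⟨ cong (_* ⟨ α , α ⟩) (coroot-pair≡⟨,⟩*factor α v) ⟩
  ⟨ α , v ⟩ * coroot-factor α * ⟨ α , α ⟩    ≡⟨ ℚP.*-assoc ⟨ α , v ⟩ _ _ ⟩
  ⟨ α , v ⟩ * (coroot-factor α * ⟨ α , α ⟩)  ≡⟨ cong (⟨ α , v ⟩ *_) (coroot-factor*⟨α,α⟩ α ⟨α,α⟩≢0) ⟩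
  ⟨ α , v ⟩ * two                            ≡⟨ ℚP.*-comm ⟨ α , v ⟩ two ⟩
  two * ⟨ α , v ⟩                            ∎
  where open ≡-Reasoning

coroot-pair-self : (α : V n) → ⟨ α , α ⟩ ≢ 0ℚ → coroot-pair α α ≡ two
coroot-pair-self α ⟨α,α⟩≢0 = begin
  coroot-pair α α                 ≡⟨ coroot-pair≡⟨,⟩*factor α α ⟩
  ⟨ α , α ⟩ * coroot-factor α     ≡⟨ ℚP.*-comm ⟨ α , α ⟩ _ ⟩
  coroot-factor α * ⟨ α , α ⟩     ≡⟨ coroot-factor*⟨α,α⟩ α ⟨α,α⟩≢0 ⟩
  two                             ∎
  where open ≡-Reasoning

coroot-pair-[u-c·v] : (α u v : V n) (c : ℚ) → coroot-pair α (u -ᵥ (c ·ᵥ v)) ≡ coroot-pair α u - c * coroot-pair α v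
coroot-pair-[u-c·v] α u v c
  rewrite coroot-pair≡⟨,⟩*factor α (u -ᵥ (c ·ᵥ v)) | coroot-pair≡⟨,⟩*factor α u | coroot-pair≡⟨,⟩*factor α v
        | ⟨,⟩-subᵥ α u (c ·ᵥ v) | ⟨,⟩-·ᵥ α v c =
  solve 4 (λ a b c k → (a :- c :* b) :* k := a :* k :- c :* (b :* k)) refl ⟨ α , u ⟩ ⟨ α , v ⟩ c (coroot-factor α)

⟨,s⟩ : (u α v : V n) → ⟨ u , s α v ⟩ ≡ ⟨ u , v ⟩ - coroot-pair α v * ⟨ u , α ⟩
⟨,s⟩ u α v = trans (⟨,⟩-subᵥ u v _) (cong (λ t → ⟨ u , v ⟩ - t) (⟨,⟩-·ᵥ u α (coroot-pair α v)))

s-adjoint : (α u v : V n) → ⟨ s α u , v ⟩ ≡ ⟨ u , s α v ⟩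
s-adjoint α u v = begin
  ⟨ s α u , v ⟩                                                ≡⟨ ⟨,⟩-comm (s α u) v ⟩
  ⟨ v , s α u ⟩                                                ≡⟨ ⟨,s⟩ v α u ⟩
  ⟨ v , u ⟩ - coroot-pair α u * ⟨ v , α ⟩                      ≡⟨ cong₂ (λ a b → ⟨ v , u ⟩ - a * b)
                                                                   (coroot-pair≡⟨,⟩*factor α u) (⟨,⟩-comm v α) ⟩
  ⟨ v , u ⟩ - ⟨ α , u ⟩ * coroot-factor α * ⟨ α , v ⟩          ≡⟨ cong₂ _-_ (⟨,⟩-comm v u) (symmetric ⟨ α , u ⟩ ⟨ α , v ⟩) ⟩
  ⟨ u , v ⟩ - ⟨ α , v ⟩ * coroot-factor α * ⟨ α , u ⟩          ≡⟨ cong₂ (λ a b → ⟨ u , v ⟩ - a * b)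
                                                                   (sym (coroot-pair≡⟨,⟩*factor α v)) (⟨,⟩-comm α u) ⟩
  ⟨ u , v ⟩ - coroot-pair α v * ⟨ u , α ⟩                      ≡⟨ sym (⟨,s⟩ u α v) ⟩
  ⟨ u , s α v ⟩                                                ∎
  where
  open ≡-Reasoning
  symmetric : ∀ a b → a * coroot-factor α * b ≡ b * coroot-factor α * a
  symmetric a b = solve 3 (λ a b k → a :* k :* b := b :* k :* a) refl a b (coroot-factor α)

s-self : (α : V n) → ⟨ α , α ⟩ ≢ 0ℚ → s α α ≡ negᵥ α
s-self α ⟨α,α⟩≢0 = trans (cong (λ c → α -ᵥ (c ·ᵥ α)) (coroot-pair-self α ⟨α,α⟩≢0)) (pointwise α)
  where
  pointwise : ∀ {m} (v : V m) → v -ᵥ (two ·ᵥ v) ≡ negᵥ v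
  pointwise []      = refl
  pointwise (x ∷ v) = cong₂ _∷_ (solve 1 (λ x → x :- con two :* x := :- x) refl x) (pointwise v)

s-involutive : (α v : V n) → ⟨ α , α ⟩ ≢ 0ℚ → s α (s α v) ≡ v
s-involutive α v ⟨α,α⟩≢0 = begin
  s α (s α v)                                              ≡⟨ cong (λ c → s α v -ᵥ (c ·ᵥ α)) pairing ⟩
  s α v -ᵥ ((coroot-pair α v - coroot-pair α v * two) ·ᵥ α)  ≡⟨ pointwise v α (coroot-pair α v) ⟩
  v                                                        ∎
  where
  open ≡-Reasoning
  pairing : coroot-pair α (s α v) ≡ coroot-pair α v - coroot-pair α v * two
  pairing = trans (coroot-pair-[u-c·v] α v α (coroot-pair α v))
                  (cong (λ t → coroot-pair α v - coroot-pair α v * t) (coroot-pair-self α ⟨α,α⟩≢0))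
  pointwise : ∀ {m} (v α : V m) c → (v -ᵥ (c ·ᵥ α)) -ᵥ ((c - c * two) ·ᵥ α) ≡ v
  pointwise []      []      c = refl
  pointwise (x ∷ v) (z ∷ α) c =
    cong₂ _∷_ (solve 3 (λ x z c → (x :- c :* z) :- (c :- c :* con two) :* z := x) refl x z c) (pointwise v α c)

s[v-α]≡α+s[v] : (α v : V n) → ⟨ α , α ⟩ ≢ 0ℚ → s α (v -ᵥ α) ≡ α +ᵥ s α v
s[v-α]≡α+s[v] α v ⟨α,α⟩≢0 = begin
  s α (v -ᵥ α)                                 ≡⟨ cong (λ w → s α (v -ᵥ w)) (sym (·ᵥ-identityˡ α)) ⟩
  s α (v -ᵥ (1ℚ ·ᵥ α))                           ≡⟨ cong (λ c → (v -ᵥ (1ℚ ·ᵥ α)) -ᵥ (c ·ᵥ α)) pairing ⟩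
  (v -ᵥ (1ℚ ·ᵥ α)) -ᵥ ((coroot-pair α v - two) ·ᵥ α) ≡⟨ pointwise v α (coroot-pair α v) ⟩
  α +ᵥ s α v                                   ∎
  where
  open ≡-Reasoning
  pairing : coroot-pair α (v -ᵥ (1ℚ ·ᵥ α)) ≡ coroot-pair α v - two
  pairing = trans (coroot-pair-[u-c·v] α v α 1ℚ)
                  (cong (λ t → coroot-pair α v - t) (trans (ℚP.*-identityˡ _) (coroot-pair-self α ⟨α,α⟩≢0)))
  pointwise : ∀ {m} (v α : V m) c → (v -ᵥ (1ℚ ·ᵥ α)) -ᵥ ((c - two) ·ᵥ α) ≡ α +ᵥ (v -ᵥ (c ·ᵥ α))
  pointwise []      []      c = refl
  pointwise (x ∷ v) (z ∷ α) c =
    cong₂ _∷_ (solve 3 (λ x z c → (x :- con 1ℚ :* z) :- (c :- con two) :* z := z :+ (x :- c :* z)) refl x z c)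
              (pointwise v α c)

negᵥ-generic : ∀ {Φ : List (V n)} u → IsGeneric Φ u → IsGeneric Φ (negᵥ u)
negᵥ-generic u u-generic {γ} γ∈Φ ⟨-u,γ⟩≡0 =
  u-generic γ∈Φ (trans (sym (neg-involutive _)) (cong -_ (trans (sym (⟨negᵥ,⟩ u γ)) ⟨-u,γ⟩≡0)))

-- Root systems and the action of words

module _ {Φ : List (V n)} (u : V n) (u-generic : IsGeneric Φ u) {γ : V n} (γ∈Φ : γ ∈ Φ) where

  generic-≮0⇒>0 : ¬ ⟨ u , γ ⟩ < 0ℚ → 0ℚ < ⟨ u , γ ⟩
  generic-≮0⇒>0 ≮0 with ≢0⇒<0⊎>0 (u-generic γ∈Φ)
  ... | inj₁ <0 = ⊥-elim (≮0 <0)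
  ... | inj₂ >0 = >0

  generic-≯0⇒<0 : ¬ 0ℚ < ⟨ u , γ ⟩ → ⟨ u , γ ⟩ < 0ℚ
  generic-≯0⇒<0 ≯0 with ≢0⇒<0⊎>0 (u-generic γ∈Φ)
  ... | inj₁ <0 = <0
  ... | inj₂ >0 = ⊥-elim (≯0 >0)

PositiveRoot : List (V n) → V n → V n → Set
PositiveRoot Φ u γ = γ ∈ Φ × 0ℚ < ⟨ u , γ ⟩

Decomposable : List (V n) → V n → V n → Set
Decomposable Φ u α = ∃₂ λ β₁ β₂ → PositiveRoot Φ u β₁ × PositiveRoot Φ u β₂ × β₁ +ᵥ β₂ ≡ α

Flipped : V n → V n → V n → Set
Flipped u α β = 0ℚ < ⟨ u , β ⟩ × β ≢ α × ⟨ u , s α β ⟩ < 0ℚ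

flipped? : (u α : V n) → Decidable (Flipped u α)
flipped? u α β = ℚP._<?_ 0ℚ ⟨ u , β ⟩ ×-dec ¬? (β ≟ᵥ α) ×-dec ℚP._<?_ ⟨ u , s α β ⟩ 0ℚ

record IsPositiveSystem (Φ : List (V n)) (Q : Pred (V n) 0ℓ) : Set where
  field
    Q?      : Decidable Q
    total   : ∀ {γ} → γ ∈ Φ → ¬ Q γ → Q (negᵥ γ)
    antisym : ∀ {γ} → γ ∈ Φ → Q γ → ¬ Q (negᵥ γ)
    closed  : ∀ {α β} → α ∈ Φ → β ∈ Φ → Q α → Q β → α +ᵥ β ∈ Φ → Q (α +ᵥ β)

module _ {Φ : List (V n)} (RS : IsRootSystem Φ) where
  open IsRootSystem RS

  0<⟨α,α⟩ : ∀ {α} → α ∈ Φ → 0ℚ < ⟨ α , α ⟩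
  0<⟨α,α⟩ {α} α∈Φ with ℚP._≤?_ ⟨ α , α ⟩ 0ℚ
  ... | yes ⟨α,α⟩≤0 = ⊥-elim (nonzero (subst (_∈ Φ) (⟨u,u⟩≤0⇒u≡0 α ⟨α,α⟩≤0) α∈Φ))
  ... | no ⟨α,α⟩≰0  = ℚP.≰⇒> ⟨α,α⟩≰0

  ⟨α,α⟩≢0 : ∀ {α} → α ∈ Φ → ⟨ α , α ⟩ ≢ 0ℚ
  ⟨α,α⟩≢0 α∈Φ ⟨α,α⟩≡0 = ℚP.<-irrefl (sym ⟨α,α⟩≡0) (0<⟨α,α⟩ α∈Φ)

  s-generic : ∀ {α} → α ∈ Φ → ∀ u → IsGeneric Φ u → IsGeneric Φ (s α u)
  s-generic {α} α∈Φ u u-generic {γ} γ∈Φ ⟨sαu,γ⟩≡0 =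
    u-generic (refl-stable α∈Φ γ∈Φ) (trans (sym (s-adjoint α u γ)) ⟨sαu,γ⟩≡0)

  coroot-pair-pos-sym : ∀ {α β} → α ∈ Φ → β ∈ Φ → 0ℚ < coroot-pair α β → 0ℚ < coroot-pair β α
  coroot-pair-pos-sym {α} {β} α∈Φ β∈Φ 0<c =
    0<p*q⇒0<p (0<⟨α,α⟩ β∈Φ) (subst (0ℚ <_) (sym c′B≡cA) (0<p*q 0<c (0<⟨α,α⟩ α∈Φ)))
    where
    c′B≡cA : coroot-pair β α * ⟨ β , β ⟩ ≡ coroot-pair α β * ⟨ α , α ⟩
    c′B≡cA = trans (coroot-pair*⟨α,α⟩ β α (⟨α,α⟩≢0 β∈Φ))
                   (trans (cong (two *_) (⟨,⟩-comm β α)) (sym (coroot-pair*⟨α,α⟩ α β (⟨α,α⟩≢0 α∈Φ))))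

  coroots≥2⇒≡ : ∀ {α β} → α ∈ Φ → β ∈ Φ → two ≤ coroot-pair α β → two ≤ coroot-pair β α → α ≡ β
  coroots≥2⇒≡ {α} {β} α∈Φ β∈Φ 2≤c 2≤c′ =
    u-v≡0⇒u≡v α β (⟨u,u⟩≤0⇒u≡0 (α -ᵥ β) (ℚP.*-cancelˡ-≤-pos two 2D≤2*0))
    where
    A = ⟨ α , α ⟩
    B = ⟨ β , β ⟩
    C = ⟨ α , β ⟩
    2A≤2C : two * A ≤ two * C
    2A≤2C = ℚP.≤-trans (ℚP.*-monoʳ-≤-nonNeg A {{ℚ.nonNegative (⟨u,u⟩-nonNeg α)}} 2≤c)
                       (ℚP.≤-reflexive (coroot-pair*⟨α,α⟩ α β (⟨α,α⟩≢0 α∈Φ)))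
    2B≤2C : two * B ≤ two * C
    2B≤2C = ℚP.≤-trans (ℚP.*-monoʳ-≤-nonNeg B {{ℚ.nonNegative (⟨u,u⟩-nonNeg β)}} 2≤c′)
                       (ℚP.≤-reflexive (trans (coroot-pair*⟨α,α⟩ β α (⟨α,α⟩≢0 β∈Φ)) (cong (two *_) (⟨,⟩-comm β α))))
    2D≤2*0 : two * ⟨ α -ᵥ β , α -ᵥ β ⟩ ≤ two * 0ℚ
    2D≤2*0 = begin
      two * ⟨ α -ᵥ β , α -ᵥ β ⟩                  ≡⟨ cong (two *_) (⟨u-v,u-v⟩ α β) ⟩
      two * ((A + B) - two * C)                  ≡⟨ solve 3 (λ a b c → con two :* ((a :+ b) :- con two :* c)
                                                        := (con two :* a :+ con two :* b) :- (con two :* c :+ con two :* c))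
                                                        refl A B C ⟩
      (two * A + two * B) - (two * C + two * C)  ≤⟨ ℚP.+-monoˡ-≤ _ (ℚP.+-mono-≤ 2A≤2C 2B≤2C) ⟩
      (two * C + two * C) - (two * C + two * C)  ≡⟨ ℚP.+-inverseʳ (two * C + two * C) ⟩
      0ℚ                                         ≡⟨ sym (ℚP.*-zeroʳ two) ⟩
      two * 0ℚ                                   ∎
      where open ℚP.≤-Reasoning

  module Chambers (φ : V n) where
    open RootData Φ φ

    act⁻¹ : List (V n) → V n → V n
    act⁻¹ []      v = v
    act⁻¹ (α ∷ w) v = act⁻¹ w (s α v)

    act-∈Φ : ∀ {w} → All (_∈ Φ) w → ∀ {v} → v ∈ Φ → act w v ∈ Φ
    act-∈Φ []            v∈Φ = v∈Φ
    act-∈Φ (α∈Φ ∷ w⊆Φ) v∈Φ = refl-stable α∈Φ (act-∈Φ w⊆Φ v∈Φ)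

    act⁻¹-∈Φ : ∀ {w} → All (_∈ Φ) w → ∀ {v} → v ∈ Φ → act⁻¹ w v ∈ Φ
    act⁻¹-∈Φ []            v∈Φ = v∈Φ
    act⁻¹-∈Φ (α∈Φ ∷ w⊆Φ) v∈Φ = act⁻¹-∈Φ w⊆Φ (refl-stable α∈Φ v∈Φ)

    act⁻¹-act : ∀ {w} → All (_∈ Φ) w → ∀ v → act⁻¹ w (act w v) ≡ v
    act⁻¹-act []                  v = refl
    act⁻¹-act {α ∷ w} (α∈Φ ∷ w⊆Φ) v =
      trans (cong (act⁻¹ w) (s-involutive α (act w v) (⟨α,α⟩≢0 α∈Φ))) (act⁻¹-act w⊆Φ v)

    act-act⁻¹ : ∀ {w} → All (_∈ Φ) w → ∀ v → act w (act⁻¹ w v) ≡ v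
    act-act⁻¹ []                  v = refl
    act-act⁻¹ {α ∷ w} (α∈Φ ∷ w⊆Φ) v =
      trans (cong (s α) (act-act⁻¹ w⊆Φ (s α v))) (s-involutive α v (⟨α,α⟩≢0 α∈Φ))

    act-adjoint : ∀ w u v → ⟨ act w u , v ⟩ ≡ ⟨ u , act⁻¹ w v ⟩
    act-adjoint []      u v = refl
    act-adjoint (α ∷ w) u v = trans (s-adjoint α (act w u) v) (act-adjoint w u (s α v))

    -- The vector w(φ): R(w) = w(Φ⁺) consists of the roots on its positive side (image⇔).
    chamber : Word → V n
    chamber w = actW w φ

    chamber-generic : IsGeneric Φ φ → (w : Word) → IsGeneric Φ (chamber w)
    chamber-generic φ-generic ([]    , [])          = φ-generic
    chamber-generic φ-generic (α ∷ w , α∈Φ ∷ w⊆Φ) = s-generic α∈Φ (act w φ) (chamber-generic φ-generic (w , w⊆Φ))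

    image⇔ : (P : ℚ → Set) (w : Word) {γ : V n} →
             (∃ λ β → (β ∈ Φ × P ⟨ φ , β ⟩) × actW w β ≡ γ) ⇔ (γ ∈ Φ × P ⟨ chamber w , γ ⟩)
    image⇔ P (w , w⊆Φ) {γ} = mk⇔ to from
      where
      to : (∃ λ β → (β ∈ Φ × P ⟨ φ , β ⟩) × act w β ≡ γ) → γ ∈ Φ × P ⟨ act w φ , γ ⟩
      to (β , (β∈Φ , Pβ) , refl) =
        act-∈Φ w⊆Φ β∈Φ , subst P (sym (trans (act-adjoint w φ (act w β)) (cong ⟨ φ ,_⟩ (act⁻¹-act w⊆Φ β)))) Pβ
      from : γ ∈ Φ × P ⟨ act w φ , γ ⟩ → ∃ λ β → (β ∈ Φ × P ⟨ φ , β ⟩) × act w β ≡ γ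
      from (γ∈Φ , Pγ) = act⁻¹ w γ , (act⁻¹-∈Φ w⊆Φ γ∈Φ , subst P (act-adjoint w φ γ) Pγ) , act-act⁻¹ w⊆Φ γ

  module _ (CR : IsCrystallographic Φ) where

    coroot-pair-pos≢1⇒≥2 : ∀ {α β} → α ∈ Φ → β ∈ Φ → 0ℚ < coroot-pair α β → coroot-pair α β ≢ 1ℚ →
                           two ≤ coroot-pair α β
    coroot-pair-pos≢1⇒≥2 α∈Φ β∈Φ 0<c c≢1 =
      let k , c≡k/1 = CR α∈Φ β∈Φ
          c≡k = trans c≡k/1 (k/1≡integer k)
      in subst (two ≤_) (sym c≡k) (integer-pos≢1⇒≥2 k (subst (0ℚ <_) c≡k 0<c) (c≢1 ∘ trans c≡k))

    root-difference : ∀ {α β} → α ∈ Φ → β ∈ Φ → α ≢ β → 0ℚ < coroot-pair α β → β -ᵥ α ∈ Φ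
    root-difference {α} {β} α∈Φ β∈Φ α≢β 0<c with coroot-pair α β ≟ 1ℚ | coroot-pair β α ≟ 1ℚ
    ... | yes c≡1 | _ = subst (_∈ Φ) sαβ≡β-α (refl-stable α∈Φ β∈Φ)
      where
      sαβ≡β-α : s α β ≡ β -ᵥ α
      sαβ≡β-α = trans (cong (λ c → β -ᵥ (c ·ᵥ α)) c≡1) (cong (β -ᵥ_) (·ᵥ-identityˡ α))
    ... | no _ | yes c′≡1 = subst (_∈ Φ) -sβα≡β-α (neg-mem (refl-stable β∈Φ α∈Φ))
      where
      -sβα≡β-α : negᵥ (s β α) ≡ β -ᵥ α
      -sβα≡β-α = trans (cong (λ c → negᵥ (α -ᵥ (c ·ᵥ β))) c′≡1)
                       (trans (cong (λ v → negᵥ (α -ᵥ v)) (·ᵥ-identityˡ β)) (-[u-v]≡v-u α β))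
    ... | no c≢1 | no c′≢1 = ⊥-elim (α≢β (coroots≥2⇒≡ α∈Φ β∈Φ
      (coroot-pair-pos≢1⇒≥2 α∈Φ β∈Φ 0<c c≢1)
      (coroot-pair-pos≢1⇒≥2 β∈Φ α∈Φ (coroot-pair-pos-sym α∈Φ β∈Φ 0<c) c′≢1)))

    module _ (u : V n) (u-generic : IsGeneric Φ u) {α} (α∈Φ : α ∈ Φ) (0<⟨u,α⟩ : 0ℚ < ⟨ u , α ⟩)
             (α-indecomposable : ¬ Decomposable Φ u α) where

      flipped-descends : ∀ {β} → β ∈ Φ → Flipped u α β → β -ᵥ α ∈ Φ × Flipped u α (β -ᵥ α)
      flipped-descends {β} β∈Φ (0<⟨u,β⟩ , β≢α , ⟨u,sαβ⟩<0) = β-α∈Φ , 0<⟨u,β-α⟩ , β-α≢α , ⟨u,sα[β-α]⟩<0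
        where
        ⟨u,β⟩<c⟨u,α⟩ : ⟨ u , β ⟩ < coroot-pair α β * ⟨ u , α ⟩
        ⟨u,β⟩<c⟨u,α⟩ = p-q<0⇒p<q (subst (_< 0ℚ) (⟨,s⟩ u α β) ⟨u,sαβ⟩<0)
        0<c : 0ℚ < coroot-pair α β
        0<c = 0<p*q⇒0<p 0<⟨u,α⟩ (ℚP.<-trans 0<⟨u,β⟩ ⟨u,β⟩<c⟨u,α⟩)
        β-α∈Φ : β -ᵥ α ∈ Φ
        β-α∈Φ = root-difference α∈Φ β∈Φ (β≢α ∘ sym) 0<c
        α-β∈Φ : α -ᵥ β ∈ Φ
        α-β∈Φ = subst (_∈ Φ) (-[u-v]≡v-u β α) (neg-mem β-α∈Φ)
        0<⟨u,β-α⟩ : 0ℚ < ⟨ u , β -ᵥ α ⟩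
        0<⟨u,β-α⟩ = generic-≮0⇒>0 u u-generic β-α∈Φ λ ⟨u,β-α⟩<0 → α-indecomposable
          (β , α -ᵥ β , (β∈Φ , 0<⟨u,β⟩) , (α-β∈Φ , 0<⟨u,α-β⟩ ⟨u,β-α⟩<0) , u+[v-u]≡v β α)
          where
          0<⟨u,α-β⟩ : ⟨ u , β -ᵥ α ⟩ < 0ℚ → 0ℚ < ⟨ u , α -ᵥ β ⟩
          0<⟨u,α-β⟩ ⟨u,β-α⟩<0 =
            subst (λ v → 0ℚ < ⟨ u , v ⟩) (-[u-v]≡v-u β α) (⟨u,v⟩<0⇒0<⟨u,-v⟩ u (β -ᵥ α) ⟨u,β-α⟩<0)
        β-α≢α : β -ᵥ α ≢ α
        β-α≢α β-α≡α with lines α∈Φ two (subst (_∈ Φ) (u-v≡v⇒u≡2v β α β-α≡α) β∈Φ)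
        ... | inj₁ ()
        ... | inj₂ ()
        sα[β-α]∈Φ : s α (β -ᵥ α) ∈ Φ
        sα[β-α]∈Φ = refl-stable α∈Φ β-α∈Φ
        ⟨u,sα[β-α]⟩<0 : ⟨ u , s α (β -ᵥ α) ⟩ < 0ℚ
        ⟨u,sα[β-α]⟩<0 = generic-≯0⇒<0 u u-generic sα[β-α]∈Φ λ 0<⟨u,sα[β-α]⟩ → α-indecomposable
          (s α (β -ᵥ α) , negᵥ (s α β) , (sα[β-α]∈Φ , 0<⟨u,sα[β-α]⟩) ,
           (neg-mem (refl-stable α∈Φ β∈Φ) , ⟨u,v⟩<0⇒0<⟨u,-v⟩ u (s α β) ⟨u,sαβ⟩<0) ,
           trans (cong (_+ᵥ negᵥ (s α β)) (s[v-α]≡α+s[v] α β (⟨α,α⟩≢0 α∈Φ))) ([u+v]-v≡u α (s α β)))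

      -- A counterexample β minimising ⟨ u , β ⟩ would yield the smaller counterexample β − α; this
      -- replaces the usual expansion of positive roots in simple roots.
      simple-reflection-positive : ∀ {β} → PositiveRoot Φ u β → β ≢ α → 0ℚ < ⟨ u , s α β ⟩
      simple-reflection-positive {β} (β∈Φ , 0<⟨u,β⟩) β≢α =
        generic-≮0⇒>0 u u-generic (refl-stable α∈Φ β∈Φ) λ ⟨u,sαβ⟩<0 →
          let m , m∈Φ , m-flipped , m-minimal = ∃-minimal (flipped? u α) ⟨ u ,_⟩ β∈Φ (0<⟨u,β⟩ , β≢α , ⟨u,sαβ⟩<0)
              m-α∈Φ , m-α-flipped = flipped-descends m∈Φ m-flipped
              ⟨u,m-α⟩<⟨u,m⟩ = subst (_< ⟨ u , m ⟩) (sym (⟨,⟩-subᵥ u m α)) (p-q<p ⟨ u , m ⟩ 0<⟨u,α⟩)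
          in <⇒≱ ⟨u,m-α⟩<⟨u,m⟩ (m-minimal m-α∈Φ m-α-flipped)

      simple-reflection-negative : ∀ {γ} → γ ∈ Φ → ⟨ u , γ ⟩ < 0ℚ → γ ≢ negᵥ α → ⟨ s α u , γ ⟩ < 0ℚ
      simple-reflection-negative {γ} γ∈Φ ⟨u,γ⟩<0 γ≢-α =
        0<-p⇒p<0 (subst (0ℚ <_) ⟨u,sα[-γ]⟩≡-⟨sαu,γ⟩ (simple-reflection-positive (neg-mem γ∈Φ , ⟨u,v⟩<0⇒0<⟨u,-v⟩ u γ ⟨u,γ⟩<0) -γ≢α))
        where
        ⟨u,sα[-γ]⟩≡-⟨sαu,γ⟩ : ⟨ u , s α (negᵥ γ) ⟩ ≡ - ⟨ s α u , γ ⟩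
        ⟨u,sα[-γ]⟩≡-⟨sαu,γ⟩ = trans (sym (s-adjoint α u (negᵥ γ))) (⟨,⟩-negᵥ (s α u) γ)
        -γ≢α : negᵥ γ ≢ α
        -γ≢α -γ≡α = γ≢-α (trans (sym (negᵥ-involutive γ)) (cong negᵥ -γ≡α))

    module _ (φ : V n) (φ-generic : IsGeneric Φ φ) {Q : Pred (V n) 0ℓ} (Q-positive : IsPositiveSystem Φ Q) where
      open RootData Φ φ using (Word)
      open Chambers φ
      open IsPositiveSystem Q-positive

      Misplaced : V n → V n → Set
      Misplaced u γ = 0ℚ < ⟨ u , γ ⟩ × ¬ Q γ

      misplaced? : ∀ u → Decidable (Misplaced u)
      misplaced? u γ = ℚP._<?_ 0ℚ ⟨ u , γ ⟩ ×-dec ¬? (Q? γ)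

      module _ (u : V n) (u-generic : IsGeneric Φ u) where

        minimal-misplaced-indecomposable : ∀ {m} → m ∈ Φ → Misplaced u m →
          (∀ {γ} → γ ∈ Φ → Misplaced u γ → ⟨ u , m ⟩ ≤ ⟨ u , γ ⟩) → ¬ Decomposable Φ u m
        minimal-misplaced-indecomposable β₁+β₂∈Φ (_ , β₁+β₂∉Q) minimal
          (β₁ , β₂ , (β₁∈Φ , 0<⟨u,β₁⟩) , (β₂∈Φ , 0<⟨u,β₂⟩) , refl) with Q? β₁ | Q? β₂
        ... | yes β₁∈Q | yes β₂∈Q = β₁+β₂∉Q (closed β₁∈Φ β₂∈Φ β₁∈Q β₂∈Q β₁+β₂∈Φ)
        ... | _        | no β₂∉Q  = <⇒≱
          (subst (⟨ u , β₂ ⟩ <_) (sym (⟨,⟩-+ᵥ u β₁ β₂)) (q<p+q ⟨ u , β₂ ⟩ 0<⟨u,β₁⟩)) (minimal β₂∈Φ (0<⟨u,β₂⟩ , β₂∉Q))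
        ... | no β₁∉Q  | _        = <⇒≱
          (subst (⟨ u , β₁ ⟩ <_) (sym (⟨,⟩-+ᵥ u β₁ β₂)) (p<p+q ⟨ u , β₁ ⟩ 0<⟨u,β₂⟩)) (minimal β₁∈Φ (0<⟨u,β₁⟩ , β₁∉Q))

        simple-misplaced : ∀ {γ} → γ ∈ Φ → Misplaced u γ → ∃ λ α → α ∈ Φ × Misplaced u α × ¬ Decomposable Φ u α
        simple-misplaced γ∈Φ γ-misplaced =
          let m , m∈Φ , m-misplaced , m-minimal = ∃-minimal (misplaced? u) ⟨ u ,_⟩ γ∈Φ γ-misplaced
          in m , m∈Φ , m-misplaced , minimal-misplaced-indecomposable m∈Φ m-misplaced m-minimal

        reflect-misplaced : ∀ {α} → α ∈ Φ → Misplaced u α → ¬ Decomposable Φ u α →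
                            ∀ {γ} → γ ∈ Φ → Misplaced (s α u) γ → Misplaced u γ
        reflect-misplaced {α} α∈Φ (0<⟨u,α⟩ , α∉Q) α-indecomposable {γ} γ∈Φ (0<⟨sαu,γ⟩ , γ∉Q)
          with γ ≟ᵥ negᵥ α
        ... | yes refl = ⊥-elim (γ∉Q (total α∈Φ α∉Q))
        ... | no γ≢-α  = generic-≮0⇒>0 u u-generic γ∈Φ ⟨u,γ⟩≮0 , γ∉Q
          where
          ⟨u,γ⟩≮0 : ¬ ⟨ u , γ ⟩ < 0ℚ
          ⟨u,γ⟩≮0 ⟨u,γ⟩<0 = ℚP.<-asym 0<⟨sαu,γ⟩
            (simple-reflection-negative u u-generic α∈Φ 0<⟨u,α⟩ α-indecomposable γ∈Φ ⟨u,γ⟩<0 γ≢-α)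

        reflect-misplaced-count : ∀ {α} → α ∈ Φ → Misplaced u α → ¬ Decomposable Φ u α →
                                  count (misplaced? (s α u)) Φ ℕ.< count (misplaced? u) Φ
        reflect-misplaced-count {α} α∈Φ α-misplaced@(0<⟨u,α⟩ , _) α-indecomposable =
          count-strictMono (misplaced? (s α u)) (misplaced? u) Φ
            (reflect-misplaced α∈Φ α-misplaced α-indecomposable) α∈Φ α-misplaced α-placed
          where
          ⟨sαu,α⟩≡⟨u,-α⟩ : ⟨ s α u , α ⟩ ≡ ⟨ u , negᵥ α ⟩
          ⟨sαu,α⟩≡⟨u,-α⟩ = trans (s-adjoint α u α) (cong ⟨ u ,_⟩ (s-self α (⟨α,α⟩≢0 α∈Φ)))
          α-placed : ¬ Misplaced (s α u) α
          α-placed (0<⟨sαu,α⟩ , _) =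
            ℚP.<-asym 0<⟨sαu,α⟩ (subst (_< 0ℚ) (sym ⟨sαu,α⟩≡⟨u,-α⟩) (0<⟨u,v⟩⇒⟨u,-v⟩<0 u α 0<⟨u,α⟩))

        none-misplaced⇒⇔ : (∀ {γ} → γ ∈ Φ → ¬ Misplaced u γ) → ∀ {γ} → γ ∈ Φ → (0ℚ < ⟨ u , γ ⟩ ⇔ Q γ)
        none-misplaced⇒⇔ none {γ} γ∈Φ = mk⇔
          (λ 0<⟨u,γ⟩ → decidable-stable (Q? γ) λ γ∉Q → none γ∈Φ (0<⟨u,γ⟩ , γ∉Q))
          (λ γ∈Q → generic-≮0⇒>0 u u-generic γ∈Φ λ ⟨u,γ⟩<0 →
             none (neg-mem γ∈Φ) (⟨u,v⟩<0⇒0<⟨u,-v⟩ u γ ⟨u,γ⟩<0 , antisym γ∈Φ γ∈Q))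

      realise : (w : Word) → Acc ℕ._<_ (count (misplaced? (chamber w)) Φ) →
                ∃ λ (w′ : Word) → ∀ {γ} → γ ∈ Φ → (0ℚ < ⟨ chamber w′ , γ ⟩ ⇔ Q γ)
      realise w (acc smaller) with any? (misplaced? (chamber w)) Φ
      ... | no none  =
        w , none-misplaced⇒⇔ (chamber w) (chamber-generic φ-generic w) (λ γ∈Φ γ-misplaced → none (lose γ∈Φ γ-misplaced))
      ... | yes some =
        let γ , γ∈Φ , γ-misplaced = find some
            α , α∈Φ , α-misplaced , α-indecomposable =
              simple-misplaced (chamber w) (chamber-generic φ-generic w) γ∈Φ γ-misplaced
        in realise (α ∷ proj₁ w , α∈Φ ∷ proj₂ w) (smaller
             (reflect-misplaced-count (chamber w) (chamber-generic φ-generic w) α∈Φ α-misplaced α-indecomposable))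

      positiveSystem⇒chamber : ∃ λ (w : Word) → ∀ {γ} → γ ∈ Φ → (0ℚ < ⟨ chamber w , γ ⟩ ⇔ Q γ)
      positiveSystem⇒chamber = realise ([] , []) (<-wellFounded _)

-- Intervals of the weak order

module _ {Φ : List (V n)} (RS : IsRootSystem Φ) (φ : V n) (R : List (V n)) (R-poset : RootData.IsΦPoset Φ φ R) where
  open IsRootSystem RS
  open RootData Φ φ
  open Chambers RS φ
  open Equivalence
  open import Data.List.Membership.DecPropositional (_≟ᵥ_ {n}) using (_∈?_)

  R⊆Φ : ∀ {γ} → γ ∈ R → γ ∈ Φ
  R⊆Φ = proj₁ R-poset

  R-antisym : Antisymmetric R
  R-antisym = proj₁ (proj₂ R-poset)

  R-+-closed : ∀ {α β} → α ∈ R → β ∈ R → α +ᵥ β ∈ Φ → α +ᵥ β ∈ R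
  R-+-closed {α} {β} α∈R β∈R α+β∈Φ =
    subst (_∈ R) 1α+1β≡α+β (proj₂ (proj₂ R-poset) α∈R β∈R 1 1 (subst (_∈ Φ) (sym 1α+1β≡α+β) α+β∈Φ))
    where
    1α+1β≡α+β : (1ℚ ·ᵥ α) +ᵥ (1ℚ ·ᵥ β) ≡ α +ᵥ β
    1α+1β≡α+β = cong₂ _+ᵥ_ (·ᵥ-identityˡ α) (·ᵥ-identityˡ β)

  -- For u = φ this is R⁻ ⊔ (Φ⁺ ∖ −R), for u = −φ it is R⁺ ⊔ (Φ⁻ ∖ −R): the R(w) and R(w′) of the interval.
  Completion : V n → V n → Set
  Completion u δ = (⟨ u , δ ⟩ < 0ℚ × δ ∈ R) ⊎ (0ℚ < ⟨ u , δ ⟩ × ¬ negᵥ δ ∈ R)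

  completion? : ∀ u → Decidable (Completion u)
  completion? u δ = (ℚP._<?_ ⟨ u , δ ⟩ 0ℚ ×-dec (δ ∈? R)) ⊎-dec (ℚP._<?_ 0ℚ ⟨ u , δ ⟩ ×-dec ¬? (negᵥ δ ∈? R))

  Coclosed : V n → Set
  Coclosed u = ∀ {α β} → α ∈ Φ → β ∈ Φ → ⟨ u , α ⟩ < 0ℚ → ⟨ u , β ⟩ < 0ℚ → α +ᵥ β ∈ R → α ∈ R ⊎ β ∈ R

  completion-negative : ∀ u {δ} → ⟨ u , δ ⟩ < 0ℚ → Completion u δ → δ ∈ R
  completion-negative u _        (inj₁ (_ , δ∈R))     = δ∈R
  completion-negative u ⟨u,δ⟩<0 (inj₂ (0<⟨u,δ⟩ , _)) = ⊥-elim (ℚP.<-asym ⟨u,δ⟩<0 0<⟨u,δ⟩)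

  completion-∩ : ∀ u {γ} → Completion u γ → Completion (negᵥ u) γ → γ ∈ R
  completion-∩ u (inj₁ (_ , γ∈R)) _                  = γ∈R
  completion-∩ u (inj₂ _)          (inj₁ (_ , γ∈R)) = γ∈R
  completion-∩ u {γ} (inj₂ (0<⟨u,γ⟩ , _)) (inj₂ (0<⟨-u,γ⟩ , _)) =
    ⊥-elim (ℚP.<-asym 0<⟨u,γ⟩ (0<-p⇒p<0 (subst (0ℚ <_) (⟨negᵥ,⟩ u γ) 0<⟨-u,γ⟩)))

  module _ (u : V n) (u-generic : IsGeneric Φ u) where

    R⊆Completion : ∀ {γ} → γ ∈ R → Completion u γ
    R⊆Completion {γ} γ∈R with ≢0⇒<0⊎>0 (u-generic (R⊆Φ γ∈R))
    ... | inj₁ ⟨u,γ⟩<0 = inj₁ (⟨u,γ⟩<0 , γ∈R)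
    ... | inj₂ 0<⟨u,γ⟩ = inj₂ (0<⟨u,γ⟩ , R-antisym γ∈R)

    completion-total : ∀ {δ} → δ ∈ Φ → ¬ Completion u δ → Completion u (negᵥ δ)
    completion-total {δ} δ∈Φ δ∉C with ≢0⇒<0⊎>0 (u-generic δ∈Φ)
    ... | inj₁ ⟨u,δ⟩<0 =
      inj₂ (⟨u,v⟩<0⇒0<⟨u,-v⟩ u δ ⟨u,δ⟩<0 , λ -[-δ]∈R → δ∉C (inj₁ (⟨u,δ⟩<0 , subst (_∈ R) (negᵥ-involutive δ) -[-δ]∈R)))
    ... | inj₂ 0<⟨u,δ⟩ with negᵥ δ ∈? R
    ...   | yes -δ∈R = inj₁ (0<⟨u,v⟩⇒⟨u,-v⟩<0 u δ 0<⟨u,δ⟩ , -δ∈R)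
    ...   | no -δ∉R  = ⊥-elim (δ∉C (inj₂ (0<⟨u,δ⟩ , -δ∉R)))

    completion-antisym : ∀ {δ} → Completion u δ → ¬ Completion u (negᵥ δ)
    completion-antisym {δ} (inj₁ (⟨u,δ⟩<0 , _)) (inj₁ (⟨u,-δ⟩<0 , _)) =
      ℚP.<-asym ⟨u,-δ⟩<0 (⟨u,v⟩<0⇒0<⟨u,-v⟩ u δ ⟨u,δ⟩<0)
    completion-antisym {δ} (inj₁ (_ , δ∈R)) (inj₂ (_ , -[-δ]∉R)) =
      -[-δ]∉R (subst (_∈ R) (sym (negᵥ-involutive δ)) δ∈R)
    completion-antisym (inj₂ (_ , -δ∉R)) (inj₁ (_ , -δ∈R)) = -δ∉R -δ∈R
    completion-antisym {δ} (inj₂ (0<⟨u,δ⟩ , _)) (inj₂ (0<⟨u,-δ⟩ , _)) =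
      ℚP.<-asym 0<⟨u,-δ⟩ (0<⟨u,v⟩⇒⟨u,-v⟩<0 u δ 0<⟨u,δ⟩)

    module _ (coclosed : Coclosed u) where

      completion-closed-mixed : ∀ {α β} → β ∈ Φ → α ∈ R → 0ℚ < ⟨ u , β ⟩ → ¬ negᵥ β ∈ R →
                                α +ᵥ β ∈ Φ → Completion u (α +ᵥ β)
      completion-closed-mixed {α} {β} β∈Φ α∈R 0<⟨u,β⟩ -β∉R α+β∈Φ with ≢0⇒<0⊎>0 (u-generic α+β∈Φ)
      ... | inj₁ ⟨u,α+β⟩<0 =
        inj₁ (⟨u,α+β⟩<0 , [ id , ⊥-elim ∘ -β∉R ]′
          (coclosed α+β∈Φ (neg-mem β∈Φ) ⟨u,α+β⟩<0 (0<⟨u,v⟩⇒⟨u,-v⟩<0 u β 0<⟨u,β⟩)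
                    (subst (_∈ R) (sym ([u+v]-v≡u α β)) α∈R)))
      ... | inj₂ 0<⟨u,α+β⟩ =
        inj₂ (0<⟨u,α+β⟩ , λ -[α+β]∈R → -β∉R (subst (_∈ R) (-[u+v]+u≡-v α β)
          (R-+-closed -[α+β]∈R α∈R (subst (_∈ Φ) (sym (-[u+v]+u≡-v α β)) (neg-mem β∈Φ)))))

      completion-closed : ∀ {α β} → α ∈ Φ → β ∈ Φ → Completion u α → Completion u β →
                          α +ᵥ β ∈ Φ → Completion u (α +ᵥ β)
      completion-closed {α} {β} _ _ (inj₁ (⟨u,α⟩<0 , α∈R)) (inj₁ (⟨u,β⟩<0 , β∈R)) α+β∈Φ =
        inj₁ (subst (_< 0ℚ) (sym (⟨,⟩-+ᵥ u α β)) (ℚP.+-mono-< ⟨u,α⟩<0 ⟨u,β⟩<0) , R-+-closed α∈R β∈R α+β∈Φ)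
      completion-closed {α} {β} α∈Φ β∈Φ (inj₂ (0<⟨u,α⟩ , -α∉R)) (inj₂ (0<⟨u,β⟩ , -β∉R)) _ =
        inj₂ (subst (0ℚ <_) (sym (⟨,⟩-+ᵥ u α β)) (ℚP.+-mono-< 0<⟨u,α⟩ 0<⟨u,β⟩) , λ -[α+β]∈R → [ -α∉R , -β∉R ]′
          (coclosed (neg-mem α∈Φ) (neg-mem β∈Φ) (0<⟨u,v⟩⇒⟨u,-v⟩<0 u α 0<⟨u,α⟩) (0<⟨u,v⟩⇒⟨u,-v⟩<0 u β 0<⟨u,β⟩)
                    (subst (_∈ R) (negᵥ-distrib-+ᵥ α β) -[α+β]∈R)))
      completion-closed α∈Φ β∈Φ (inj₁ (_ , α∈R)) (inj₂ (0<⟨u,β⟩ , -β∉R)) α+β∈Φ =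
        completion-closed-mixed β∈Φ α∈R 0<⟨u,β⟩ -β∉R α+β∈Φ
      completion-closed {α} {β} α∈Φ β∈Φ (inj₂ (0<⟨u,α⟩ , -α∉R)) (inj₁ (_ , β∈R)) α+β∈Φ =
        subst (Completion u) (+ᵥ-comm β α)
          (completion-closed-mixed α∈Φ β∈R 0<⟨u,α⟩ -α∉R (subst (_∈ Φ) (+ᵥ-comm α β) α+β∈Φ))

      completion-positiveSystem : IsPositiveSystem Φ (Completion u)
      completion-positiveSystem = record
        { Q?      = completion? u
        ; total   = completion-total
        ; antisym = λ _ → completion-antisym
        ; closed  = completion-closed
        }

  module _ (φ-generic : IsGeneric Φ φ) where

    WOIP⇒Condition : InWOIP R → Condition R
    WOIP⇒Condition (w , w′ , w≤w′ , R≡R[w,w′]) = coclosed⁻ , coclosed⁺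
      where
      R⇒chambers : ∀ {γ} → γ ∈ R → 0ℚ < ⟨ chamber w , γ ⟩ × 0ℚ < ⟨ chamber w′ , γ ⟩
      R⇒chambers γ∈R =
        let γ∈Rw , γ∈Rw′ = proj₁ (R≡R[w,w′] _) γ∈R
        in proj₂ (to (image⇔ (0ℚ <_) w) γ∈Rw) , proj₂ (to (image⇔ (0ℚ <_) w′) γ∈Rw′)

      chambers⇒R : ∀ {γ} → γ ∈ Φ → 0ℚ < ⟨ chamber w , γ ⟩ → 0ℚ < ⟨ chamber w′ , γ ⟩ → γ ∈ R
      chambers⇒R γ∈Φ 0<⟨w,γ⟩ 0<⟨w′,γ⟩ =
        proj₂ (R≡R[w,w′] _) (from (image⇔ (0ℚ <_) w) (γ∈Φ , 0<⟨w,γ⟩) , from (image⇔ (0ℚ <_) w′) (γ∈Φ , 0<⟨w′,γ⟩))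

      inversions-grow : ∀ {γ} → Positive γ → ⟨ chamber w , γ ⟩ < 0ℚ → ⟨ chamber w′ , γ ⟩ < 0ℚ
      inversions-grow γ⁺@(γ∈Φ , _) ⟨w,γ⟩<0 =
        proj₂ (to (image⇔ (_< 0ℚ) w′) (proj₂ (w≤w′ _ (γ⁺ , from (image⇔ (_< 0ℚ) w) (γ∈Φ , ⟨w,γ⟩<0)))))

      negative⇒R : ∀ {γ} → Negative γ → 0ℚ < ⟨ chamber w , γ ⟩ → γ ∈ R
      negative⇒R {γ} (γ∈Φ , ⟨φ,γ⟩<0) 0<⟨w,γ⟩ = chambers⇒R γ∈Φ 0<⟨w,γ⟩ (⟨u,-v⟩<0⇒0<⟨u,v⟩ (chamber w′) γ
        (inversions-grow (neg-mem γ∈Φ , ⟨u,v⟩<0⇒0<⟨u,-v⟩ φ γ ⟨φ,γ⟩<0) (0<⟨u,v⟩⇒⟨u,-v⟩<0 (chamber w) γ 0<⟨w,γ⟩)))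

      positive⇒R : ∀ {γ} → Positive γ → 0ℚ < ⟨ chamber w′ , γ ⟩ → γ ∈ R
      positive⇒R γ⁺@(γ∈Φ , _) 0<⟨w′,γ⟩ = chambers⇒R γ∈Φ 0<⟨w,γ⟩ 0<⟨w′,γ⟩
        where
        0<⟨w,γ⟩ = generic-≮0⇒>0 (chamber w) (chamber-generic φ-generic w) γ∈Φ λ ⟨w,γ⟩<0 →
                    ℚP.<-asym 0<⟨w′,γ⟩ (inversions-grow γ⁺ ⟨w,γ⟩<0)

      summand-positive : ∀ u {α β} → 0ℚ < ⟨ u , α +ᵥ β ⟩ → 0ℚ < ⟨ u , α ⟩ ⊎ 0ℚ < ⟨ u , β ⟩
      summand-positive u {α} {β} = 0<p+q⇒0<p⊎0<q ∘ subst (0ℚ <_) (⟨,⟩-+ᵥ u α β)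

      coclosed⁻ : ∀ {α β} → Negative α → Negative β → α +ᵥ β ∈ R → α ∈ R ⊎ β ∈ R
      coclosed⁻ α⁻ β⁻ α+β∈R =
        Sum.map (negative⇒R α⁻) (negative⇒R β⁻) (summand-positive (chamber w) (proj₁ (R⇒chambers α+β∈R)))

      coclosed⁺ : ∀ {α β} → Positive α → Positive β → α +ᵥ β ∈ R → α ∈ R ⊎ β ∈ R
      coclosed⁺ α⁺ β⁺ α+β∈R =
        Sum.map (positive⇒R α⁺) (positive⇒R β⁺) (summand-positive (chamber w′) (proj₂ (R⇒chambers α+β∈R)))

    chambers⇒WOIP : (w w′ : Word) →
                    (∀ {γ} → γ ∈ Φ → (0ℚ < ⟨ chamber w , γ ⟩ ⇔ Completion φ γ)) →
                    (∀ {γ} → γ ∈ Φ → (0ℚ < ⟨ chamber w′ , γ ⟩ ⇔ Completion (negᵥ φ) γ)) → InWOIP R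
    chambers⇒WOIP w w′ w-chamber w′-chamber = w , w′ , w≤w′ , λ _ → R⊆R[w,w′] , R[w,w′]⊆R
      where
      -φ-generic = negᵥ-generic φ φ-generic

      w≤w′ : w ≤W w′
      w≤w′ γ (γ⁺@(γ∈Φ , 0<⟨φ,γ⟩) , γ-inverted) = γ⁺ , from (image⇔ (_< 0ℚ) w′) (γ∈Φ , ⟨w′,γ⟩<0)
        where
        ⟨w,γ⟩<0 : ⟨ chamber w , γ ⟩ < 0ℚ
        ⟨w,γ⟩<0 = proj₂ (to (image⇔ (_< 0ℚ) w) γ-inverted)
        -γ∈R : negᵥ γ ∈ R
        -γ∈R = completion-negative φ (0<⟨u,v⟩⇒⟨u,-v⟩<0 φ γ 0<⟨φ,γ⟩)
                 (to (w-chamber (neg-mem γ∈Φ)) (⟨u,v⟩<0⇒0<⟨u,-v⟩ (chamber w) γ ⟨w,γ⟩<0))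
        ⟨w′,γ⟩<0 : ⟨ chamber w′ , γ ⟩ < 0ℚ
        ⟨w′,γ⟩<0 = 0<⟨u,-v⟩⇒⟨u,v⟩<0 (chamber w′) γ
                     (from (w′-chamber (neg-mem γ∈Φ)) (R⊆Completion (negᵥ φ) -φ-generic -γ∈R))

      R⊆R[w,w′] : ∀ {γ} → γ ∈ R → InRR w w′ γ
      R⊆R[w,w′] γ∈R =
        from (image⇔ (0ℚ <_) w) (R⊆Φ γ∈R , from (w-chamber (R⊆Φ γ∈R)) (R⊆Completion φ φ-generic γ∈R)) ,
        from (image⇔ (0ℚ <_) w′) (R⊆Φ γ∈R , from (w′-chamber (R⊆Φ γ∈R)) (R⊆Completion (negᵥ φ) -φ-generic γ∈R))

      R[w,w′]⊆R : ∀ {γ} → InRR w w′ γ → γ ∈ R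
      R[w,w′]⊆R (γ∈Rw , γ∈Rw′) =
        let γ∈Φ , 0<⟨w,γ⟩ = to (image⇔ (0ℚ <_) w) γ∈Rw
            _   , 0<⟨w′,γ⟩ = to (image⇔ (0ℚ <_) w′) γ∈Rw′
        in completion-∩ φ (to (w-chamber γ∈Φ) 0<⟨w,γ⟩) (to (w′-chamber γ∈Φ) 0<⟨w′,γ⟩)

    Condition⇒WOIP : IsCrystallographic Φ → Condition R → InWOIP R
    Condition⇒WOIP CR (coclosed⁻ , coclosed⁺) =
      let w  , w-chamber  = positiveSystem⇒chamber RS CR φ φ-generic
                              (completion-positiveSystem φ φ-generic coclosed-below)
          w′ , w′-chamber = positiveSystem⇒chamber RS CR φ φ-generic
                              (completion-positiveSystem (negᵥ φ) (negᵥ-generic φ φ-generic) coclosed-above)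
      in chambers⇒WOIP w w′ w-chamber w′-chamber
      where
      coclosed-below : Coclosed φ
      coclosed-below α∈Φ β∈Φ ⟨φ,α⟩<0 ⟨φ,β⟩<0 = coclosed⁻ (α∈Φ , ⟨φ,α⟩<0) (β∈Φ , ⟨φ,β⟩<0)
      ⟨-φ,γ⟩<0⇒0<⟨φ,γ⟩ : ∀ {γ} → ⟨ negᵥ φ , γ ⟩ < 0ℚ → 0ℚ < ⟨ φ , γ ⟩
      ⟨-φ,γ⟩<0⇒0<⟨φ,γ⟩ {γ} = -p<0⇒0<p ∘ subst (_< 0ℚ) (⟨negᵥ,⟩ φ γ)
      coclosed-above : Coclosed (negᵥ φ)
      coclosed-above α∈Φ β∈Φ ⟨-φ,α⟩<0 ⟨-φ,β⟩<0 =
        coclosed⁺ (α∈Φ , ⟨-φ,γ⟩<0⇒0<⟨φ,γ⟩ ⟨-φ,α⟩<0) (β∈Φ , ⟨-φ,γ⟩<0⇒0<⟨φ,γ⟩ ⟨-φ,β⟩<0)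

proposition4p11 : ∀ (n : ℕ) (Φ : List (V n)) (φ : V n) →
    IsRootSystem Φ → IsCrystallographic Φ → IsGeneric Φ φ →
    ∀ (R : List (V n)) → RootData.IsΦPoset Φ φ R →
    (RootData.InWOIP Φ φ R → RootData.Condition Φ φ R) × (RootData.Condition Φ φ R → RootData.InWOIP Φ φ R)
proposition4p11 n Φ φ RS CR φ-generic R R-poset =
  WOIP⇒Condition RS φ R R-poset φ-generic , Condition⇒WOIP RS φ R R-poset φ-generic CR
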